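{- The currency $A=(1,a_1,a_2,a_3)$ is orderly if and only if it is totally orderly.
   Context: A currency is a finite sequence of integers $A=(a_0,a_1,\ldots,a_k)$ with $1=a_0<a_1<\cdots<a_k$. For an integer amount $c>0$, $\mathrm{opt}_A(c)$ is the minimum number of coins (values from $A$, repetitions allowed) summing to $c$, and $\mathrm{grd}_A(c)$ is the number of coins used by the greedy algorithm, which repeatedly takes the largest coin not exceeding the remaining amount. $A$ is orderly if $\mathrm{opt}_A(c)=\mathrm{grd}_A(c)$ for all integers $c>0$. $A$ is totally orderly if every prefix currency $(1,a_1,\ldots,a_l)$, $l=0,\ldots,k$, is orderly. -}

module Defs where

open import Data.Nat using (ℕ; zero; suc; _+_; _∸_; _≤_; _<_; _≤?_)
open import Data.List using (List; []; _∷_; length; take)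
open import Data.Nat.ListAction using (sum)
open import Data.Empty using (⊥)
open import Data.List.Membership.Propositional using (_∈_)
open import Data.List.Relation.Unary.All using (All)
open import Data.List.Relation.Unary.Linked using (Linked)
open import Data.Maybe using (Maybe; just; nothing)
open import Data.Product using (Σ; _×_)
open import Relation.Binary.PropositionalEquality using (_≡_)
open import Relation.Nullary using (yes; no)

IsCurrency : List ℕ → Set
IsCurrency []      = ⊥
IsCurrency (a ∷ as) = (a ≡ 1) × Linked _<_ (a ∷ as)

IsRep : List ℕ → ℕ → List ℕ → Set
IsRep A c r = All (_∈ A) r × sum r ≡ c

IsOpt : List ℕ → ℕ → ℕ → Set
IsOpt A c n = Σ (List ℕ) (λ r → IsRep A c r × length r ≡ n)
            × (∀ r → IsRep A c r → n ≤ length r)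

largest : List ℕ → ℕ → Maybe ℕ
largest []       r = nothing
largest (a ∷ as) r with largest as r
... | just b  = just b
... | nothing with a ≤? r
...   | yes _ = just a
...   | no  _ = nothing

grdFuel : List ℕ → ℕ → ℕ → ℕ
grdFuel A zero    r = 0
grdFuel A (suc f) zero = 0
grdFuel A (suc f) (suc r) with largest A (suc r)
... | just a  = suc (grdFuel A f (suc r ∸ a))
... | nothing = 0

-- grd_A(c): fuel c suffices for currencies since every coin is ≥ 1.
grd : List ℕ → ℕ → ℕ
grd A c = grdFuel A c c

Orderly : List ℕ → Set
Orderly A = ∀ c → 0 < c → IsOpt A c (grd A c)

TotallyOrderly : List ℕ → Set
TotallyOrderly A = ∀ l → l < length A → Orderly (take (suc l) A)

module Submission where

-- "Totally orderly ⇒ orderly" is the instance l = 3.  Conversely the prefixes (1) and (1, a)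
-- are orderly for every a, so the content is that orderliness of (1, a, b, d) passes to
-- (1, a, b).  Round b up to a multiple of a: b + e = (k + 1)a with e < a (k, e are unique).
--  * Sufficiency: if e ≤ k then (1, a, b) is orderly.  Count a representation as x ones,
--    y coins a and z coins b.  Unless x < a and x + ya < b (the greedy normal form, whose
--    length is the greedy count), one of three exchanges shrinks x + y without lengthening
--    it: a ones → one a;  k + 1 coins a → one b and e ones;  ones and a's worth ≥ b → one b.
--  * Necessity: if (1, a, b, d) is orderly then e ≤ k.  If (k + 1)a < d, compare greedy on
--    (k + 1)a (one b and e ones) with k + 1 coins a.  Otherwise d < a + b, and greedy pays
--    the two-coin amounts a + b and 2b starting with d, so the remainders are coins; this
--    forces d = a + b − 1 and b = 2a − 1, whence k = e = 1.
-- The file develops the greedy algorithm for currencies 1 ∷ as (module Greedy), the round-up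
-- decomposition, the one- and two-coin currencies, then ThreeCoins (sufficiency),
-- FourCoins (necessity) and finally the proposition.

open import Defs
open import Data.Nat using (ℕ; zero; suc; _+_; _*_; _∸_; _≤_; _<_; _≤?_; z≤n; s≤s; NonZero; >-nonZero)
open import Data.Nat.Properties
open import Data.Nat.DivMod using (_/_; _%_; m≡m%n+[m/n]*n; m%n<n)
open import Data.Nat.Induction using (<-rec)
open import Data.Nat.Tactic.RingSolver using (solve-∀)
open import Algebra.Properties.CommutativeSemigroup +-commutativeSemigroup using (x∙yz≈y∙xz)
open import Data.List using (List; []; _∷_; length; replicate)
open import Data.List.Properties using (length-replicate)
open import Data.Nat.ListAction using (sum)
open import Data.List.Membership.Propositional using (_∈_)
open import Data.List.Relation.Unary.Any using (here; there)
open import Data.List.Relation.Unary.All as All using (All; []; _∷_)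
open import Data.List.Relation.Unary.All.Properties using (replicate⁺)
open import Data.List.Relation.Unary.Linked using ([-]; _∷_)
open import Data.Maybe using (just; nothing)
open import Data.Product using (Σ; ∃; ∃₂; _×_; _,_; proj₁; proj₂; map₁)
open import Data.Sum using (_⊎_; inj₁; inj₂)
open import Function.Base using (_∘_)
open import Function.Bundles using (_⇔_; mk⇔)
open import Relation.Binary.PropositionalEquality
open import Relation.Nullary using (yes; no; contradiction)

largest-none : ∀ {ys c} → All (c <_) ys → largest ys c ≡ nothing
largest-none [] = refl
largest-none {y ∷ ys} {c} (c<y ∷ c<ys) rewrite largest-none c<ys with y ≤? c
... | yes y≤c = contradiction y≤c (<⇒≱ c<y)
... | no  _   = refl

largest-top : ∀ {g ys c} → g ≤ c → All (c <_) ys → largest (g ∷ ys) c ≡ just g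
largest-top {g} {ys} {c} g≤c c<ys rewrite largest-none c<ys with g ≤? c
... | yes _   = refl
... | no  g≰c = contradiction g≤c g≰c

largest-skip : ∀ {x ys c g} → largest ys c ≡ just g → largest (x ∷ ys) c ≡ just g
largest-skip eq rewrite eq = refl

largest-sound : ∀ {ys c g} → largest ys c ≡ just g → g ∈ ys × g ≤ c
largest-sound {y ∷ ys} {c} eq with largest ys c in eq′
... | just h with refl ← eq = map₁ there (largest-sound eq′)
... | nothing with y ≤? c
...   | yes y≤c with refl ← eq = here refl , y≤c
largest-sound {y ∷ ys} {c} () | nothing | no _

module Greedy (as : List ℕ) (positive : All (0 <_) as) where

  A : List ℕ
  A = 1 ∷ as

  coin-positive : ∀ {g} → g ∈ A → 0 < g
  coin-positive (here refl) = s≤s z≤n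
  coin-positive (there g∈as) = All.lookup positive g∈as

  -- Since 1 is a coin, every positive amount has a largest coin below it.
  largest-defined : ∀ r → largest A (suc r) ≢ nothing
  largest-defined r eq with largest as (suc r)
  largest-defined r () | just _
  largest-defined r () | nothing

  largest-exists : ∀ r → ∃ λ g → largest A (suc r) ≡ just g
  largest-exists r with largest A (suc r) in eq
  ... | just g  = g , refl
  ... | nothing = contradiction eq (largest-defined r)

  -- The greedy count does not depend on the fuel as long as the fuel is at least the amount,
  -- because every greedy step removes a positive coin.
  fuel-irrelevant : ∀ f f′ c → c ≤ f → c ≤ f′ → grdFuel A f c ≡ grdFuel A f′ c
  fuel-irrelevant zero    zero     zero    _ _ = refl
  fuel-irrelevant zero    (suc _)  zero    _ _ = refl
  fuel-irrelevant (suc _) zero     zero    _ _ = refl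
  fuel-irrelevant (suc _) (suc _)  zero    _ _ = refl
  fuel-irrelevant (suc f) (suc f′) (suc r) (s≤s r≤f) (s≤s r≤f′) with largest A (suc r) in eq
  ... | nothing = refl
  ... | just g  = cong suc (fuel-irrelevant f f′ (suc r ∸ g) (shrinks r≤f) (shrinks r≤f′))
    where
    shrinks : ∀ {n} → r ≤ n → suc r ∸ g ≤ n
    shrinks r≤n = ≤-trans (∸-monoʳ-≤ (suc r) (coin-positive (proj₁ (largest-sound eq)))) r≤n

  grd-take : ∀ {g r} → 0 < g → largest A (g + r) ≡ just g → grd A (g + r) ≡ suc (grd A r)
  grd-take {suc g′} {r} _ eq rewrite eq = cong suc (begin
    grdFuel A (g′ + r) (g′ + r ∸ g′) ≡⟨ cong (grdFuel A (g′ + r)) (m+n∸m≡n g′ r) ⟩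
    grdFuel A (g′ + r) r             ≡⟨ fuel-irrelevant (g′ + r) r r (m≤n+m r g′) ≤-refl ⟩
    grd A r                          ∎)
    where open ≡-Reasoning

  greedy-rep : ∀ f c → c ≤ f → Σ (List ℕ) λ l → IsRep A c l × length l ≡ grdFuel A f c
  greedy-rep zero    zero    _ = [] , ([] , refl) , refl
  greedy-rep (suc f) zero    _ = [] , ([] , refl) , refl
  greedy-rep (suc f) (suc r) (s≤s r≤f) with largest A (suc r) in eq
  ... | nothing = contradiction eq (largest-defined r)
  ... | just g with largest-sound eq
  ...   | g∈A , g≤c with greedy-rep f (suc r ∸ g) (≤-trans (∸-monoʳ-≤ (suc r) (coin-positive g∈A)) r≤f)
  ...     | l , (l⊆A , sum-l) , len-l =
    g ∷ l , (g∈A ∷ l⊆A , trans (cong (g +_) sum-l) (m+[n∸m]≡n g≤c)) , cong suc len-l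

  orderly-if-greedy-minimal : (∀ c l → IsRep A c l → grd A c ≤ length l) → Orderly A
  orderly-if-greedy-minimal minimal c _ = greedy-rep c c ≤-refl , minimal c

  grd-small : ∀ {x} → All (x <_) as → grd A x ≡ x
  grd-small {zero}  _     = refl
  grd-small {suc x} above =
    trans (grd-take {1} {x} (s≤s z≤n) (largest-top (s≤s z≤n) above))
          (cong suc (grd-small (All.map (<-trans (n<1+n x)) above)))

  grd-repeat : ∀ g r n → 0 < g → (∀ c → g ≤ c → c ≤ r + n * g → largest A c ≡ just g) →
               grd A (r + n * g) ≡ n + grd A r
  grd-repeat g r zero    _   _      = cong (grd A) (+-identityʳ r)
  grd-repeat g r (suc n) g>0 choose = begin
    grd A (r + (g + n * g))  ≡⟨ cong (grd A) (x∙yz≈y∙xz r g (n * g)) ⟩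
    grd A (g + (r + n * g))  ≡⟨ grd-take g>0 (choose _ (m≤m+n g _) (≤-reflexive (x∙yz≈y∙xz g r (n * g)))) ⟩
    suc (grd A (r + n * g))  ≡⟨ cong suc (grd-repeat g r n g>0 λ c g≤c c≤ → choose c g≤c (≤-trans c≤ smaller)) ⟩
    suc (n + grd A r)        ∎
    where
    open ≡-Reasoning
    smaller : r + n * g ≤ r + (g + n * g)
    smaller = +-monoʳ-≤ r (m≤n+m (n * g) g)

  grd-positive : ∀ r → 0 < grd A (suc r)
  grd-positive r with largest A (suc r) in eq
  ... | just _  = s≤s z≤n
  ... | nothing = contradiction eq (largest-defined r)

  coin-if-grd≤1 : ∀ {c} → 0 < c → grd A c ≤ 1 → c ∈ A
  coin-if-grd≤1 {suc r} _ grd≤1 with largest-exists r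
  ... | g , eq with largest-sound eq
  ...   | g∈A , g≤c with m≤n⇒∃[o]m+o≡n g≤c
  ...     | zero  , g+0≡c = subst (_∈ A) (trans (sym (+-identityʳ g)) g+0≡c) g∈A
  ...     | suc t , g+t≡c = contradiction grd≤1 (<⇒≱ (begin-strict
    1                     <⟨ s≤s (grd-positive t) ⟩
    suc (grd A (suc t))   ≡⟨ grd-take (coin-positive g∈A) (trans (cong (largest A) g+t≡c) eq) ⟨
    grd A (g + suc t)     ≡⟨ cong (grd A) g+t≡c ⟩
    grd A (suc r)         ∎))
    where open ≤-Reasoning

  greedy-bound : Orderly A → ∀ {c l} → 0 < c → IsRep A c l → grd A c ≤ length l
  greedy-bound orderly {c} {l} 0<c rep = proj₂ (orderly c 0<c) l rep

  remainder-coin : Orderly A → ∀ {u v g r} → u ∈ A → v ∈ A → u + v ≡ g + r →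
                   largest A (g + r) ≡ just g → 0 < r → r ∈ A
  remainder-coin orderly {u} {v} {g} {r} u∈A v∈A u+v≡g+r eq 0<r = coin-if-grd≤1 0<r (≤-pred (begin
    suc (grd A r)  ≡⟨ grd-take g>0 eq ⟨
    grd A (g + r)  ≤⟨ greedy-bound orderly (≤-trans 0<r (m≤n+m r g)) two-coins ⟩
    2              ∎))
    where
    open ≤-Reasoning
    g>0 : 0 < g
    g>0 = coin-positive (proj₁ (largest-sound eq))
    two-coins : IsRep A (g + r) (u ∷ v ∷ [])
    two-coins = (u∈A ∷ v∈A ∷ []) , trans (cong (u +_) (+-identityʳ v)) u+v≡g+r

round-up : ∀ a b → 0 < a → 0 < b → ∃₂ λ k e → b + e ≡ suc k * a × e < a
round-up (suc a′) (suc zero)    _   _ = 0 , a′ , sym (+-identityʳ (suc a′)) , ≤-refl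
round-up a        (suc (suc b)) 0<a _ with round-up a (suc b) 0<a (s≤s z≤n)
... | k , suc e , b+e≡ , e<a = k , e , trans (sym (+-suc (suc b) e)) b+e≡ , <-trans (n<1+n e) e<a
... | k , zero  , b+0≡ , _   with a | 0<a
...   | suc a′ | _ = suc k , a′ , (begin
  suc (suc b) + a′        ≡⟨ cong suc (sym (+-suc b a′)) ⟩
  suc b + suc a′          ≡⟨ +-comm (suc b) (suc a′) ⟩
  suc a′ + suc b          ≡⟨ cong (suc a′ +_) (trans (sym (+-identityʳ (suc b))) b+0≡) ⟩
  suc a′ + suc k * suc a′ ∎) , ≤-refl
  where open ≡-Reasoning

round-up-below : ∀ {a b k e} → b + e ≡ suc k * a → e < a → k * a < b
round-up-below {a} {b} {k} {e} b+e≡ e<a = +-cancelˡ-< a (k * a) b (begin-strict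
  a + k * a  ≡⟨ b+e≡ ⟨
  b + e      <⟨ +-monoʳ-< b e<a ⟩
  b + a      ≡⟨ +-comm b a ⟩
  a + b      ∎)
  where open ≤-Reasoning

-- Comparing two round-ups of b: ka < b ≤ (k′ + 1)a forces k ≤ k′.
round-up-index≤ : ∀ {a b k e k′ e′} → b + e ≡ suc k * a → e < a → b + e′ ≡ suc k′ * a → k ≤ k′
round-up-index≤ {a} {b} {k} {e} {k′} {e′} b+e≡ e<a b+e′≡ = ≤-pred (*-cancelʳ-< a k (suc k′) (begin-strict
  k * a       <⟨ round-up-below {k = k} b+e≡ e<a ⟩
  b           ≤⟨ m≤m+n b e′ ⟩
  b + e′      ≡⟨ b+e′≡ ⟩
  suc k′ * a  ∎))
  where open ≤-Reasoning

round-up-unique : ∀ {a b k e k′ e′} → b + e ≡ suc k * a → e < a → b + e′ ≡ suc k′ * a → e′ < a →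
                  k ≡ k′ × e ≡ e′
round-up-unique {a} {b} {k} {e} {k′} {e′} b+e≡ e<a b+e′≡ e′<a = k≡k′ , +-cancelˡ-≡ b e e′ (begin
  b + e      ≡⟨ b+e≡ ⟩
  suc k * a  ≡⟨ cong (λ n → suc n * a) k≡k′ ⟩
  suc k′ * a ≡⟨ b+e′≡ ⟨
  b + e′     ∎)
  where
  open ≡-Reasoning
  k≡k′ : k ≡ k′
  k≡k′ = ≤-antisym (round-up-index≤ b+e≡ e<a b+e′≡) (round-up-index≤ b+e′≡ e′<a b+e≡)

sum-replicate : ∀ n a → sum (replicate n a) ≡ n * a
sum-replicate zero    a = refl
sum-replicate (suc n) a = cong (a +_) (sum-replicate n a)

module OneCoin where
  open Greedy [] []

  sum-of-ones : ∀ {l} → All (_∈ A) l → sum l ≡ length l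
  sum-of-ones []                 = refl
  sum-of-ones (here refl ∷ ones) = cong suc (sum-of-ones ones)

  orderly-one-coin : Orderly (1 ∷ [])
  orderly-one-coin = orderly-if-greedy-minimal λ c l (l⊆A , sum≡c) →
    ≤-reflexive (trans (grd-small []) (trans (sym sum≡c) (sum-of-ones l⊆A)))

module TwoCoins (a : ℕ) (1<a : 1 < a) where
  0<a : 0 < a
  0<a = <-trans (s≤s z≤n) 1<a

  open Greedy (a ∷ []) (0<a ∷ [])

  instance
    a-nonZero : NonZero a
    a-nonZero = >-nonZero 0<a

  count : ∀ {l} → All (_∈ A) l → ∃₂ λ x y → sum l ≡ x + y * a × length l ≡ x + y
  count [] = 0 , 0 , refl , refl
  count (here refl ∷ coins) with count coins
  ... | x , y , sum≡ , len≡ = suc x , y , cong suc sum≡ , cong suc len≡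
  count (there (here refl) ∷ coins) with count coins
  ... | x , y , sum≡ , len≡ = x , suc y , trans (cong (a +_) sum≡) (x∙yz≈y∙xz a x (y * a)) ,
                              trans (cong suc len≡) (sym (+-suc x y))

  chooses-a : ∀ {c} → a ≤ c → largest A c ≡ just a
  chooses-a a≤c = largest-skip {ys = a ∷ []} (largest-top a≤c [])

  grd-normal : ∀ {x} y → x < a → grd A (x + y * a) ≡ x + y
  grd-normal {x} y x<a = begin
    grd A (x + y * a)  ≡⟨ grd-repeat a x y 0<a (λ _ a≤c _ → chooses-a a≤c) ⟩
    y + grd A x        ≡⟨ cong (y +_) (grd-small (x<a ∷ [])) ⟩
    y + x              ≡⟨ +-comm y x ⟩
    x + y              ∎
    where open ≡-Reasoning

  -- Writing x = (x mod a) + (x div a)a, greedy pays x + ya with at most x + y coins.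
  grd-bound : ∀ x y → grd A (x + y * a) ≤ x + y
  grd-bound x y = begin
    grd A (x + y * a)               ≡⟨ cong (grd A) regroup ⟩
    grd A (x % a + (x / a + y) * a) ≡⟨ grd-normal (x / a + y) (m%n<n x a) ⟩
    x % a + (x / a + y)             ≤⟨ +-monoʳ-≤ (x % a) (+-monoˡ-≤ y (m≤m*n (x / a) a)) ⟩
    x % a + (x / a * a + y)         ≡⟨ sym (+-assoc (x % a) (x / a * a) y) ⟩
    x % a + x / a * a + y           ≡⟨ cong (_+ y) (m≡m%n+[m/n]*n x a) ⟨
    x + y                           ∎
    where
    open ≤-Reasoning
    regroup : x + y * a ≡ x % a + (x / a + y) * a
    regroup = trans (cong (_+ y * a) (m≡m%n+[m/n]*n x a)) (distribute (x % a) (x / a) y a)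
      where
      distribute : ∀ r q y a → r + q * a + y * a ≡ r + (q + y) * a
      distribute = solve-∀

  orderly-two-coins : Orderly (1 ∷ a ∷ [])
  orderly-two-coins = orderly-if-greedy-minimal minimal
    where
    minimal : ∀ c l → IsRep A c l → grd A c ≤ length l
    minimal c l (l⊆A , sum≡c) with count l⊆A
    ... | x , y , sum≡ , len≡ = subst₂ _≤_ (cong (grd A) (trans (sym sum≡) sum≡c)) (sym len≡) (grd-bound x y)

module ThreeCoins (a b : ℕ) (1<a : 1 < a) (a<b : a < b) where
  0<a : 0 < a
  0<a = <-trans (s≤s z≤n) 1<a

  open Greedy (a ∷ b ∷ []) (0<a ∷ <-trans 0<a a<b ∷ [])

  value : ℕ → ℕ → ℕ → ℕ
  value x y z = x + y * a + z * b

  size : ℕ → ℕ → ℕ → ℕ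
  size x y z = x + y + z

  count : ∀ {l} → All (_∈ A) l → ∃ λ x → ∃₂ λ y z → sum l ≡ value x y z × length l ≡ size x y z
  count [] = 0 , 0 , 0 , refl , refl
  count (here refl ∷ coins) with count coins
  ... | x , y , z , sum≡ , len≡ = suc x , y , z , cong suc sum≡ , cong suc len≡
  count (there (here refl) ∷ coins) with count coins
  ... | x , y , z , sum≡ , len≡ = x , suc y , z , trans (cong (a +_) sum≡) (add-a x y z a b) ,
                                  trans (cong suc len≡) (add-one x y z)
    where
    add-a : ∀ x y z a b → a + (x + y * a + z * b) ≡ x + (a + y * a) + z * b
    add-a = solve-∀
    add-one : ∀ x y z → suc (x + y + z) ≡ x + suc y + z
    add-one = solve-∀
  count (there (there (here refl)) ∷ coins) with count coins
  ... | x , y , z , sum≡ , len≡ = x , y , suc z , trans (cong (b +_) sum≡) (x∙yz≈y∙xz b (x + y * a) (z * b)) ,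
                                  trans (cong suc len≡) (sym (+-suc (x + y) z))

  chooses-b : ∀ {c} → b ≤ c → largest A c ≡ just b
  chooses-b b≤c = largest-skip {ys = a ∷ b ∷ []} (largest-skip {ys = b ∷ []} (largest-top b≤c []))

  chooses-a : ∀ {c} → a ≤ c → c < b → largest A c ≡ just a
  chooses-a a≤c c<b = largest-skip {ys = a ∷ b ∷ []} (largest-top a≤c (c<b ∷ []))

  grd-normal : ∀ {x y} z → x < a → x + y * a < b → grd A (value x y z) ≡ size x y z
  grd-normal {x} {y} z x<a x+ya<b = begin
    grd A (x + y * a + z * b) ≡⟨ grd-repeat b (x + y * a) z (<-trans 0<a a<b) (λ _ b≤c _ → chooses-b b≤c) ⟩
    z + grd A (x + y * a)     ≡⟨ cong (z +_) (grd-repeat a x y 0<a (λ _ a≤c c≤ → chooses-a a≤c (≤-<-trans c≤ x+ya<b))) ⟩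
    z + (y + grd A x)         ≡⟨ cong (λ n → z + (y + n)) (grd-small (x<a ∷ <-trans x<a a<b ∷ [])) ⟩
    z + (y + x)               ≡⟨ reorder z y x ⟩
    x + y + z                 ∎
    where
    open ≡-Reasoning
    reorder : ∀ z y x → z + (y + x) ≡ x + y + z
    reorder = solve-∀

  record Improvement (x y z : ℕ) : Set where
    field
      x′ y′ z′   : ℕ
      same-value : value x′ y′ z′ ≡ value x y z
      decreasing : x′ + y′ < x + y
      z′≤1+z     : z′ ≤ suc z

  improvement-no-longer : ∀ {x y z} (i : Improvement x y z) →
                          let open Improvement i in size x′ y′ z′ ≤ size x y z
  improvement-no-longer {x} {y} {z} i = begin
    x′ + y′ + z′      ≤⟨ +-monoʳ-≤ (x′ + y′) z′≤1+z ⟩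
    x′ + y′ + suc z   ≡⟨ +-suc (x′ + y′) z ⟩
    suc (x′ + y′) + z ≤⟨ +-monoˡ-≤ z decreasing ⟩
    x + y + z         ∎
    where
    open ≤-Reasoning
    open Improvement i

  trade-ones : ∀ {x y z} → a ≤ x → Improvement x y z
  trade-ones {x} {y} {z} a≤x with m≤n⇒∃[o]m+o≡n a≤x
  ... | x′ , refl = record
    { x′ = x′ ; y′ = suc y ; z′ = z
    ; same-value = regroup x′ y z a b
    ; decreasing = begin-strict
        x′ + suc y      ≡⟨ +-suc x′ y ⟩
        suc (x′ + y)    <⟨ n<1+n _ ⟩
        2 + (x′ + y)    ≤⟨ +-monoˡ-≤ (x′ + y) 1<a ⟩
        a + (x′ + y)    ≡⟨ +-assoc a x′ y ⟨
        a + x′ + y      ∎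
    ; z′≤1+z = n≤1+n z }
    where
    open ≤-Reasoning
    regroup : ∀ x′ y z a b → x′ + (a + y * a) + z * b ≡ a + x′ + y * a + z * b
    regroup = solve-∀

  module Sufficiency {k e : ℕ} (b+e≡ : b + e ≡ suc k * a) (e<a : e < a) (e≤k : e ≤ k) where

    ka<b : k * a < b
    ka<b = round-up-below {k = k} b+e≡ e<a

    -- k + 1 coins a are exchanged for one b and e ones (possible since ya ≥ b > ka).
    trade-as : ∀ {x y z} → b ≤ y * a → Improvement x y z
    trade-as {x} {y} {z} b≤ya with m≤n⇒∃[o]m+o≡n (*-cancelʳ-< a k y (<-≤-trans ka<b b≤ya))
    ... | y′ , refl = record
      { x′ = x + e ; y′ = y′ ; z′ = suc z
      ; same-value = begin-equality
          x + e + y′ * a + (b + z * b)   ≡⟨ shuffle x e y′ z a b ⟩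
          x + y′ * a + (b + e) + z * b   ≡⟨ cong (λ n → x + y′ * a + n + z * b) b+e≡ ⟩
          x + y′ * a + suc k * a + z * b ≡⟨ collect x y′ (suc k) z a b ⟩
          x + (suc k + y′) * a + z * b   ∎
      ; decreasing = begin-strict
          x + e + y′       ≤⟨ +-monoˡ-≤ y′ (+-monoʳ-≤ x e≤k) ⟩
          x + k + y′       ≡⟨ +-assoc x k y′ ⟩
          x + (k + y′)     <⟨ +-monoʳ-< x (n<1+n _) ⟩
          x + suc (k + y′) ∎
      ; z′≤1+z = ≤-refl }
      where
      open ≤-Reasoning
      shuffle : ∀ x e y′ z a b → x + e + y′ * a + (b + z * b) ≡ x + y′ * a + (b + e) + z * b
      shuffle = solve-∀
      collect : ∀ x y′ n z a b → x + y′ * a + n * a + z * b ≡ x + (n + y′) * a + z * b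
      collect = solve-∀

    trade-mixed : ∀ {x y z} → y * a < b → b ≤ x + y * a → Improvement x y z
    trade-mixed {x} {y} {z} ya<b b≤x+ya with m≤n⇒∃[o]m+o≡n b≤x+ya
    ... | w , b+w≡ = record
      { x′ = w ; y′ = 0 ; z′ = suc z
      ; same-value = begin-equality
          w + 0 + (b + z * b) ≡⟨ shuffle w z b ⟩
          b + w + z * b       ≡⟨ cong (_+ z * b) b+w≡ ⟩
          x + y * a + z * b   ∎
      ; decreasing = begin-strict
          w + 0 ≡⟨ +-identityʳ w ⟩
          w     <⟨ w<x ⟩
          x     ≤⟨ m≤m+n x y ⟩
          x + y ∎
      ; z′≤1+z = ≤-refl }
      where
      open ≤-Reasoning
      shuffle : ∀ w z b → w + 0 + (b + z * b) ≡ b + w + z * b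
      shuffle = solve-∀
      w<x : w < x
      w<x = +-cancelˡ-< b w x (begin-strict
        b + w     ≡⟨ b+w≡ ⟩
        x + y * a <⟨ +-monoʳ-< x ya<b ⟩
        x + b     ≡⟨ +-comm x b ⟩
        b + x     ∎)

    improve : ∀ x y z → (x < a × x + y * a < b) ⊎ Improvement x y z
    improve x y z with a ≤? x | b ≤? y * a | b ≤? x + y * a
    ... | yes a≤x | _        | _          = inj₂ (trade-ones a≤x)
    ... | no  _   | yes b≤ya | _          = inj₂ (trade-as b≤ya)
    ... | no  _   | no  b≰ya | yes b≤x+ya = inj₂ (trade-mixed (≰⇒> b≰ya) b≤x+ya)
    ... | no  a≰x | no  _    | no  b≰x+ya = inj₁ (≰⇒> a≰x , ≰⇒> b≰x+ya)

    Bounded : ℕ → Set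
    Bounded m = ∀ x y z → x + y ≡ m → grd A (value x y z) ≤ size x y z

    bounded : ∀ m → Bounded m
    bounded = <-rec Bounded step
      where
      step : ∀ m → (∀ {m′} → m′ < m → Bounded m′) → Bounded m
      step m smaller x y z refl with improve x y z
      ... | inj₁ (x<a , x+ya<b) = ≤-reflexive (grd-normal z x<a x+ya<b)
      ... | inj₂ i = begin
        grd A (value x y z)    ≡⟨ cong (grd A) same-value ⟨
        grd A (value x′ y′ z′) ≤⟨ smaller decreasing x′ y′ z′ refl ⟩
        size x′ y′ z′          ≤⟨ improvement-no-longer i ⟩
        size x y z             ∎
        where
        open ≤-Reasoning
        open Improvement i

    orderly-three-coins : Orderly (1 ∷ a ∷ b ∷ [])
    orderly-three-coins = orderly-if-greedy-minimal minimal
      where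
      minimal : ∀ c l → IsRep A c l → grd A c ≤ length l
      minimal c l (l⊆A , sum≡c) with count l⊆A
      ... | x , y , z , sum≡ , len≡ =
        subst₂ _≤_ (cong (grd A) (trans (sym sum≡) sum≡c)) (sym len≡) (bounded (x + y) x y z refl)

module FourCoins (a b d : ℕ) (1<a : 1 < a) (a<b : a < b) (b<d : b < d) where
  0<a : 0 < a
  0<a = <-trans (s≤s z≤n) 1<a

  0<b : 0 < b
  0<b = <-trans 0<a a<b

  open Greedy (a ∷ b ∷ d ∷ []) (0<a ∷ 0<b ∷ <-trans 0<b b<d ∷ [])

  chooses-d : ∀ {c} → d ≤ c → largest A c ≡ just d
  chooses-d d≤c = largest-skip {ys = a ∷ b ∷ d ∷ []} (largest-skip {ys = b ∷ d ∷ []}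
                    (largest-skip {ys = d ∷ []} (largest-top d≤c [])))

  chooses-b : ∀ {c} → b ≤ c → c < d → largest A c ≡ just b
  chooses-b b≤c c<d = largest-skip {ys = a ∷ b ∷ d ∷ []} (largest-skip {ys = b ∷ d ∷ []} (largest-top b≤c (c<d ∷ [])))

  a∈A : a ∈ A
  a∈A = there (here refl)

  b∈A : b ∈ A
  b∈A = there (there (here refl))

  coin-below-a : ∀ {r} → r ∈ A → r < a → r ≡ 1
  coin-below-a (here r≡1)                          _   = r≡1
  coin-below-a (there (here refl))                 r<a = contradiction r<a (<-irrefl refl)
  coin-below-a (there (there (here refl)))         r<a = contradiction r<a (<-asym a<b)
  coin-below-a (there (there (there (here refl)))) r<a = contradiction (<-trans a<b b<d) (<-asym r<a)

  remainder-after-top : Orderly A → ∀ {u v} → u ∈ A → v ∈ A → d < u + v → ∃ λ r → d + r ≡ u + v × r ∈ A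
  remainder-after-top orderly {u} {v} u∈A v∈A d<u+v with m≤n⇒∃[o]m+o≡n d<u+v
  ... | t , 1+d+t≡ = suc t , d+r≡ ,
        remainder-coin orderly u∈A v∈A (sym d+r≡) (chooses-d (m≤m+n d (suc t))) (s≤s z≤n)
    where
    d+r≡ : d + suc t ≡ u + v
    d+r≡ = trans (+-suc d t) 1+d+t≡

  remainder-below-a : ∀ {r} → d + r ≡ a + b → r < a
  remainder-below-a {r} d+r≡ = +-cancelˡ-< b r a (begin-strict
    b + r ≡⟨ +-comm b r ⟩
    r + b <⟨ +-monoʳ-< r b<d ⟩
    r + d ≡⟨ +-comm r d ⟩
    d + r ≡⟨ d+r≡ ⟩
    a + b ≡⟨ +-comm a b ⟩
    b + a ∎)
    where open ≤-Reasoning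

  -- Orderliness at the amount a + b: if d < a + b, the remainder is the coin 1, so d = a + b − 1.
  top-after-two-coins : Orderly A → d < a + b → suc d ≡ a + b
  top-after-two-coins orderly d<a+b with remainder-after-top orderly a∈A b∈A d<a+b
  ... | r , d+r≡ , r∈A with coin-below-a r∈A (remainder-below-a d+r≡)
  ...   | refl = trans (+-comm 1 d) d+r≡

  -- Orderliness at the amount 2b when d = a + b − 1: the remainder b − a + 1 must be a coin,
  -- and the only possibility is the coin a, i.e. b = 2a − 1.
  b-after-two-coins : Orderly A → suc d ≡ a + b → b + 1 ≡ 2 * a
  b-after-two-coins orderly 1+d≡ with remainder-after-top orderly b∈A b∈A
                                        (subst (_≤ b + b) (sym 1+d≡) (+-monoˡ-≤ b (<⇒≤ a<b)))
  ... | r , d+1≡ , here refl =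
    contradiction (+-cancelʳ-≡ b a b (trans (sym 1+d≡) (trans (+-comm 1 d) d+1≡))) (<⇒≢ a<b)
  ... | r , d+a≡ , there (here refl) = +-cancelˡ-≡ b (b + 1) (2 * a) (begin
    b + (b + 1)     ≡⟨ cong (b +_) (+-comm b 1) ⟩
    b + suc b       ≡⟨ +-suc b b ⟩
    suc (b + b)     ≡⟨ cong suc d+a≡ ⟨
    suc d + a       ≡⟨ cong (_+ a) 1+d≡ ⟩
    a + b + a       ≡⟨ regroup a b ⟩
    b + 2 * a       ∎)
    where
    open ≡-Reasoning
    regroup : ∀ a b → a + b + a ≡ b + 2 * a
    regroup = solve-∀
  ... | r , d+b≡ , there (there (here refl)) =
    contradiction (+-cancelʳ-≡ b d b d+b≡) (<⇒≢ b<d ∘ sym)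
  ... | r , d+d≡ , there (there (there (here refl))) =
    contradiction d+d≡ (<⇒≢ (+-mono-< b<d b<d) ∘ sym)

  -- If b + e = (k + 1)a < d, greedy pays b + e as b and e ones, against k + 1 coins a.
  below-top : Orderly A → ∀ {k e} → b + e ≡ suc k * a → e < a → b + e < d → e ≤ k
  below-top orderly {k} {e} b+e≡ e<a b+e<d = ≤-pred (begin
    suc e                        ≡⟨ cong suc (grd-small (e<a ∷ <-trans e<a a<b ∷ <-trans e<a (<-trans a<b b<d) ∷ [])) ⟨
    suc (grd A e)                ≡⟨ grd-take 0<b (chooses-b (m≤m+n b e) b+e<d) ⟨
    grd A (b + e)                ≤⟨ greedy-bound orderly (≤-trans 0<b (m≤m+n b e)) k+1-coins-a ⟩
    length (replicate (suc k) a) ≡⟨ length-replicate (suc k) ⟩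
    suc k                        ∎)
    where
    open ≤-Reasoning
    k+1-coins-a : IsRep A (b + e) (replicate (suc k) a)
    k+1-coins-a = replicate⁺ (suc k) a∈A , trans (sum-replicate (suc k) a) (sym b+e≡)

  -- If d < a + b then b + 1 = 2a, whose round-up decomposition is k = e = 1.
  above-top : Orderly A → ∀ {k e} → b + e ≡ suc k * a → e < a → d < a + b → e ≤ k
  above-top orderly {k} b+e≡ e<a d<a+b
    with round-up-unique {k = k} {k′ = 1} b+e≡ e<a
           (b-after-two-coins orderly (top-after-two-coins orderly d<a+b)) 1<a
  ... | refl , refl = ≤-refl

  necessity : Orderly A → ∀ {k e} → b + e ≡ suc k * a → e < a → e ≤ k
  necessity orderly {k} {e} b+e≡ e<a with d <? a + b
  ... | yes d<a+b = above-top orderly b+e≡ e<a d<a+b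
  ... | no  d≮a+b = below-top orderly b+e≡ e<a (<-≤-trans b+e<a+b (≮⇒≥ d≮a+b))
    where
    b+e<a+b : b + e < a + b
    b+e<a+b = subst (_< a + b) (+-comm e b) (+-monoˡ-< b e<a)

three-coin-prefix-orderly : ∀ {a b d} → 1 < a → a < b → b < d →
                            Orderly (1 ∷ a ∷ b ∷ d ∷ []) → Orderly (1 ∷ a ∷ b ∷ [])
three-coin-prefix-orderly {a} {b} {d} 1<a a<b b<d orderly
  with round-up a b (<-trans (s≤s z≤n) 1<a) (<-trans (<-trans (s≤s z≤n) 1<a) a<b)
... | k , e , b+e≡ , e<a =
  ThreeCoins.Sufficiency.orderly-three-coins a b 1<a a<b {k} b+e≡ e<a
    (FourCoins.necessity a b d 1<a a<b b<d orderly {k} b+e≡ e<a)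

proposition4p1 : (a₁ a₂ a₃ : ℕ) → IsCurrency (1 ∷ a₁ ∷ a₂ ∷ a₃ ∷ []) →
    Orderly (1 ∷ a₁ ∷ a₂ ∷ a₃ ∷ []) ⇔ TotallyOrderly (1 ∷ a₁ ∷ a₂ ∷ a₃ ∷ [])
proposition4p1 a₁ a₂ a₃ (refl , 1<a₁ ∷ a₁<a₂ ∷ a₂<a₃ ∷ [-]) = mk⇔ every-prefix whole
  where
  every-prefix : Orderly (1 ∷ a₁ ∷ a₂ ∷ a₃ ∷ []) → TotallyOrderly (1 ∷ a₁ ∷ a₂ ∷ a₃ ∷ [])
  every-prefix _       0 _ = OneCoin.orderly-one-coin
  every-prefix _       1 _ = TwoCoins.orderly-two-coins a₁ 1<a₁
  every-prefix orderly 2 _ = three-coin-prefix-orderly 1<a₁ a₁<a₂ a₂<a₃ orderly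
  every-prefix orderly 3 _ = orderly
  every-prefix _ (suc (suc (suc (suc _)))) (s≤s (s≤s (s≤s (s≤s ()))))

  whole : TotallyOrderly (1 ∷ a₁ ∷ a₂ ∷ a₃ ∷ []) → Orderly (1 ∷ a₁ ∷ a₂ ∷ a₃ ∷ [])
  whole totally = totally 3 ≤-refl
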